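{- Let $H$ be a finite $r$-uniform hypergraph on $n$ vertices and let $k\ge1$ be an integer. Then $f(H,1,k)=n-M(H,k-1)$.
   Context: An orientation $D$ of an $r$-uniform hypergraph $H$ assigns to each edge a linear ordering of its $r$ vertices (positions $1,\dots,r$). For a vertex $v$ and $1\le i\le r$, $\deg_i(v)$ is the number of edges in which $v$ occupies position $i$. $f(D,1,k)$ is the number of vertices $v$ with $\deg_i(v)\ge k$ for all $i=1,\dots,r$, and $f(H,1,k)$ is the minimum of $f(D,1,k)$ over all orientations $D$ of $H$. For $F\subseteq V(H)$, $e(F)$ is the number of edges contained in $F$; for $A\subseteq V(H)$ nonempty, ${\rm Mad}(A)=\max\{r\,e(F)/|F|:\emptyset\ne F\subseteq A\}$ (the maximum average degree of the induced subhypergraph $H[A]$; the empty set is considered to satisfy any upper bound on ${\rm Mad}$). For an integer $j$, $M(H,j)=\max|A_1\cup\dots\cup A_r|$, the maximum over all pairwise vertex-disjoint (possibly empty) sets $A_1,\dots,A_r\subseteq V(H)$ with ${\rm Mad}(A_i)\le rj$ for each $i$. -}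

module Defs where

open import Data.Nat using (ℕ; zero; suc; _+_; _*_; _∸_; _≤_)
open import Data.Bool using (Bool; true; false; if_then_else_)
open import Data.Fin using (Fin; zero; suc; _≟_)
open import Data.Fin.Subset using (Subset; _∈_; _⊆_; Nonempty; ∣_∣; ⋃)
open import Data.Fin.Subset.Properties using (_∈?_)
open import Data.Fin.Properties using (all?)
open import Data.Fin.Permutation using (Permutation′; _⟨$⟩ʳ_)
open import Data.List using (List)
import Data.List as List
open import Data.Product using (Σ; ∃; _×_; _,_)
open import Function.Bundles using (_⇔_)
open import Relation.Nullary using (¬_; Dec; yes; no)
open import Relation.Nullary.Decidable using (⌊_⌋)
open import Relation.Binary.PropositionalEquality using (_≡_)

count : ∀ {m} → (Fin m → Bool) → ℕ
count {zero}  P = 0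
count {suc m} P = (if P zero then 1 else 0) + count (λ i → P (suc i))

-- Edge j is given by an injective map Fin r → Fin n (its r distinct vertices);
-- distinct edges have distinct vertex sets (no multiple edges).
record Hypergraph (n r : ℕ) : Set where
  field
    m        : ℕ
    edge     : Fin m → Fin r → Fin n
    edge-inj : ∀ j (a b : Fin r) → edge j a ≡ edge j b → a ≡ b
    simple   : ∀ j j' → (∀ v → (∃ λ a → edge j a ≡ v) ⇔ (∃ λ a → edge j' a ≡ v)) → j ≡ j'
open Hypergraph public

-- An orientation: each edge gets a linear ordering of its r vertices,
-- i.e. a permutation; position i of edge j holds vertex edge j (π j ⟨$⟩ʳ i).
Orientation : ∀ {n r} → Hypergraph n r → Set
Orientation {r = r} H = Fin (m H) → Permutation′ r

at : ∀ {n r} (H : Hypergraph n r) → Orientation H → Fin (m H) → Fin r → Fin n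
at H D j i = edge H j (D j ⟨$⟩ʳ i)

deg : ∀ {n r} (H : Hypergraph n r) → Orientation H → Fin r → Fin n → ℕ
deg H D i v = count (λ j → ⌊ at H D j i ≟ v ⌋)

fD : ∀ {n r} (H : Hypergraph n r) → Orientation H → ℕ → ℕ
fD {n} {r} H D k = count {n} (λ v → ⌊ all? (λ i → Data.Nat._≤?_ k (deg H D i v)) ⌋)

IsFH1k : ∀ {n r} → Hypergraph n r → ℕ → ℕ → Set
IsFH1k H k x = (∃ λ (D : Orientation H) → fD H D k ≡ x) × (∀ (D : Orientation H) → x ≤ fD H D k)

eIn : ∀ {n r} → Hypergraph n r → Subset n → ℕ
eIn H F = count (λ j → ⌊ all? (λ a → edge H j a ∈? F) ⌋)

-- Mad(A) ≤ r * j, i.e. r e(F)/|F| ≤ r j for all nonempty F ⊆ A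
-- (written with |F| > 0 multiplied out).
MadLe : ∀ {n r} → Hypergraph n r → Subset n → ℕ → Set
MadLe {n} {r} H A j = ∀ (F : Subset n) → F ⊆ A → Nonempty F → r * eIn H F ≤ (r * j) * ∣ F ∣

Admissible : ∀ {n r} → Hypergraph n r → ℕ → (Fin r → Subset n) → Set
Admissible {n} {r} H j A =
  (∀ (i i' : Fin r) (v : Fin n) → v ∈ A i → v ∈ A i' → i ≡ i') × (∀ i → MadLe H (A i) j)

unionSize : ∀ {n r} → (Fin r → Subset n) → ℕ
unionSize {r = r} A = ∣ ⋃ (List.tabulate {n = r} A) ∣

IsMHj : ∀ {n r} → Hypergraph n r → ℕ → ℕ → Set
IsMHj {n} {r} H j y =
  (∃ λ (A : Fin r → Subset n) → Admissible H j A × unionSize A ≡ y)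
  × (∀ (A : Fin r → Subset n) → Admissible H j A → unionSize A ≤ y)

-- Both inequalities come from translating between orientations and admissible families.
-- Given an orientation D, put every vertex v that is not counted by f(D,1,k) into one class A_i
-- with deg_i(v) ≤ k-1. An edge inside F ⊆ A_i has its i-th vertex in F, so
-- e(F) ≤ Σ_{v ∈ F} deg_i(v) ≤ (k-1)|F|; hence n - f(D,1,k) ≤ M(H,k-1).
-- Conversely, for admissible A_1, …, A_r, Hakimi's theorem assigns to every edge inside A_i a head
-- so that each vertex of A_i heads at most k-1 of them. Such an edge is ordered with its head in
-- position i, and every other edge is permuted so that no vertex of A_p lands in position p. Then
-- deg_i(v) ≤ k-1 for v ∈ A_i, so f(D,1,k) ≤ n - |A_1 ∪ … ∪ A_r|.
-- Hakimi's theorem goes by induction on the edges: the first edge can be placed on one of its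
-- vertices whose capacity can drop by one without breaking sparsity, since otherwise the tight sets
-- through its vertices, closed under union by supermodularity of the edge count, would unite to an
-- overfull set.

module Submission where

open import Defs
open import Data.Bool using (Bool; true; false; if_then_else_; _∧_; _∨_; T)
open import Data.Bool.Properties using (T-∧; T-∨)
open import Data.Empty using (⊥-elim)
open import Data.Fin using (Fin; zero; suc; _≟_)
open import Data.Fin.Permutation using (Permutation′; _⟨$⟩ʳ_; _⟨$⟩ˡ_; transpose; _∘ₚ_; inverseʳ)
import Data.Fin.Permutation as Permutation
import Data.Fin.Permutation.Components as PC
open import Data.Fin.Properties using (all?; any?; ¬∀⟶∃¬; suc-injective)
open import Data.Fin.Subset using (Subset; inside; outside; _∈_; _∉_; _⊆_; _∪_; _∩_; ∁; ∣_∣; ⋃; ⊥; ⁅_⁆)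
open import Data.Fin.Subset.Properties
  using (_∈?_; _⊆?_; nonempty?; anySubset?; ∉⊥; x∈⁅x⁆; x∈p∪q⁻; x∈p∪q⁺; x∈p∩q⁺; x∉p⇒x∈∁p; x∈∁p⇒x∉p;
         ⊆-antisym; p∩q⊆p; p⊆q⇒∣p∣≤∣q∣; ∣p∣≤n; ∣⊥∣≡0; ∣∁p∣≡n∸∣p∣; ∣p∩q∣≤∣q∣)
open import Data.List using (List; []; _∷_; allFin)
import Data.List as List
open import Data.List.Membership.Propositional.Properties using (∈-allFin)
open import Data.List.Properties using (tabulate-cong)
open import Data.List.Relation.Unary.All as All using (All; []; _∷_)
open import Data.Nat using (ℕ; zero; suc; pred; _+_; _*_; _∸_; _≤_; _<_; z≤n; s≤s; s≤s⁻¹; _≤?_; _<?_; >-nonZero)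
open import Data.Nat.Properties
  using (≤-refl; ≤-reflexive; ≤-trans; ≤-antisym; <-irrefl; ≤∧≢⇒<; <⇒≱; ≰⇒>; ≮⇒≥; n≤1+n; n<1+n; n≤0⇒n≡0; n<1⇒n≡0;
         m≤n+m; +-identityʳ; +-assoc; +-suc; +-mono-≤; +-monoˡ-≤; +-monoʳ-≤; +-cancelʳ-≤; +-commutativeSemigroup;
         *-identityˡ; *-zeroʳ; *-suc; *-assoc; *-monoʳ-≤; *-cancelˡ-≤; suc-pred; ∸-monoʳ-≤; m∸[m∸n]≡n;
         module ≤-Reasoning)
open import Data.Product using (Σ; ∃; _×_; _,_; proj₁; proj₂)
open import Data.Sum using (inj₁; inj₂; [_,_])
open import Data.Vec using ([]; _∷_; here; there; tabulate)
open import Data.Vec.Functional as Vector using (updateAt; head; tail)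
open import Data.Vec.Functional.Properties using (updateAt-updates; updateAt-minimal)
open import Function using (_∘_; const; Equivalence)
open import Relation.Nullary using (¬_; Dec; yes; no; ¬?)
open import Relation.Nullary.Decidable using (⌊_⌋; _×-dec_; _→-dec_; toWitness; fromWitness; decidable-stable)
open import Relation.Unary using (Pred; Decidable)
open import Relation.Binary.PropositionalEquality
  using (_≡_; _≢_; _≗_; refl; sym; trans; cong; cong₂; subst; module ≡-Reasoning)

open Equivalence using (to; from)
open import Algebra.Properties.CommutativeSemigroup +-commutativeSemigroup using (interchange; x∙yz≈y∙xz)

count≡∣tabulate∣ : ∀ {m} (P : Fin m → Bool) → count P ≡ ∣ tabulate P ∣
count≡∣tabulate∣ {zero}  P = refl
count≡∣tabulate∣ {suc m} P with P zero
... | true  = cong suc (count≡∣tabulate∣ (P ∘ suc))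
... | false = count≡∣tabulate∣ (P ∘ suc)

∈-tabulate⁺ : ∀ {m} {P : Fin m → Bool} x → T (P x) → x ∈ tabulate P
∈-tabulate⁺ {P = P} zero    Px with P zero
... | true = here
∈-tabulate⁺         (suc x) Px = there (∈-tabulate⁺ x Px)

∈-tabulate⁻ : ∀ {m} {P : Fin m → Bool} x → x ∈ tabulate P → T (P x)
∈-tabulate⁻ {P = P} zero    x∈ with P zero | x∈
... | true | here = _
∈-tabulate⁻         (suc x) (there x∈) = ∈-tabulate⁻ x x∈

count-mono : ∀ {m} {P Q : Fin m → Bool} → (∀ j → T (P j) → T (Q j)) → count P ≤ count Q
count-mono {P = P} {Q} P⇒Q = begin
  count P            ≡⟨ count≡∣tabulate∣ P ⟩
  ∣ tabulate P ∣     ≤⟨ p⊆q⇒∣p∣≤∣q∣ (λ {x} x∈ → ∈-tabulate⁺ x (P⇒Q x (∈-tabulate⁻ x x∈))) ⟩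
  ∣ tabulate Q ∣     ≡⟨ sym (count≡∣tabulate∣ Q) ⟩
  count Q            ∎
  where open ≤-Reasoning

∈-⋃-tabulate⁺ : ∀ {n r} (A : Fin r → Subset n) {x} i → x ∈ A i → x ∈ ⋃ (List.tabulate A)
∈-⋃-tabulate⁺ A zero    x∈ = x∈p∪q⁺ (inj₁ x∈)
∈-⋃-tabulate⁺ A (suc i) x∈ = x∈p∪q⁺ (inj₂ (∈-⋃-tabulate⁺ (A ∘ suc) i x∈))

∈-⋃-tabulate⁻ : ∀ {n r} (A : Fin r → Subset n) {x} → x ∈ ⋃ (List.tabulate A) → ∃ λ i → x ∈ A i
∈-⋃-tabulate⁻ {r = zero}  A x∈ = ⊥-elim (∉⊥ x∈)
∈-⋃-tabulate⁻ {r = suc r} A x∈ with x∈p∪q⁻ (A zero) _ x∈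
... | inj₁ x∈A₀ = zero , x∈A₀
... | inj₂ x∈⋃ with ∈-⋃-tabulate⁻ (A ∘ suc) x∈⋃
...   | i , x∈Aᵢ = suc i , x∈Aᵢ

allSubset? : ∀ {n ℓ} {P : Pred (Subset n) ℓ} → Decidable P → Dec (∀ F → P F)
allSubset? P? with anySubset? (¬? ∘ P?)
... | yes (F , ¬PF) = no λ ∀P → ¬PF (∀P F)
... | no  ∄¬P       = yes λ F → decidable-stable (P? F) (λ ¬PF → ∄¬P (F , ¬PF))

tabulate-∨ : ∀ {m} (P Q : Fin m → Bool) → tabulate (λ j → P j ∨ Q j) ≡ tabulate P ∪ tabulate Q
tabulate-∨ {zero}  P Q = refl
tabulate-∨ {suc m} P Q = cong ((P zero ∨ Q zero) ∷_) (tabulate-∨ (P ∘ suc) (Q ∘ suc))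

tabulate-∧ : ∀ {m} (P Q : Fin m → Bool) → tabulate (λ j → P j ∧ Q j) ≡ tabulate P ∩ tabulate Q
tabulate-∧ {zero}  P Q = refl
tabulate-∧ {suc m} P Q = cong ((P zero ∧ Q zero) ∷_) (tabulate-∧ (P ∘ suc) (Q ∘ suc))

count-false : ∀ {m} → count {m} (λ _ → false) ≡ 0
count-false {zero}  = refl
count-false {suc m} = count-false {m}

weight : ∀ {n} → (Fin n → ℕ) → Subset n → ℕ
weight w []            = 0
weight w (inside  ∷ F) = w zero + weight (w ∘ suc) F
weight w (outside ∷ F) = weight (w ∘ suc) F

weight-const : ∀ {n} c (F : Subset n) → weight (const c) F ≡ c * ∣ F ∣
weight-const c []            = sym (*-zeroʳ c)
weight-const c (inside  ∷ F) = trans (cong (c +_) (weight-const c F)) (sym (*-suc c ∣ F ∣))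
weight-const c (outside ∷ F) = weight-const c F

weight-⊥ : ∀ {n} (w : Fin n → ℕ) → weight w ⊥ ≡ 0
weight-⊥ {zero}  w = refl
weight-⊥ {suc n} w = weight-⊥ (w ∘ suc)

weight-⁅⁆ : ∀ {n} (w : Fin n → ℕ) v → weight w ⁅ v ⁆ ≡ w v
weight-⁅⁆ w zero    = trans (cong (w zero +_) (weight-⊥ (w ∘ suc))) (+-identityʳ (w zero))
weight-⁅⁆ w (suc v) = weight-⁅⁆ (w ∘ suc) v

weight-mono : ∀ {n} {w w′ : Fin n → ℕ} (F : Subset n) → (∀ {u} → u ∈ F → w u ≤ w′ u) → weight w F ≤ weight w′ F
weight-mono []            w≤w′ = z≤n
weight-mono (inside  ∷ F) w≤w′ = +-mono-≤ (w≤w′ here) (weight-mono F (w≤w′ ∘ there))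
weight-mono (outside ∷ F) w≤w′ = weight-mono F (w≤w′ ∘ there)

weight-+ : ∀ {n} (w w′ : Fin n → ℕ) F → weight (λ u → w u + w′ u) F ≡ weight w F + weight w′ F
weight-+ w w′ []            = refl
weight-+ w w′ (inside  ∷ F) = trans (cong (w zero + w′ zero +_) (weight-+ (w ∘ suc) (w′ ∘ suc) F))
                                    (interchange (w zero) (w′ zero) _ _)
weight-+ w w′ (outside ∷ F) = weight-+ (w ∘ suc) (w′ ∘ suc) F

weight-modular : ∀ {n} (w : Fin n → ℕ) (F G : Subset n) →
                 weight w (F ∪ G) + weight w (F ∩ G) ≡ weight w F + weight w G
weight-modular w [] [] = refl
weight-modular w (x ∷ F) (y ∷ G) = cons x y (weight-modular (w ∘ suc) F G)
  where
  a = w zero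
  W = weight (w ∘ suc)
  cons : ∀ x y → W (F ∪ G) + W (F ∩ G) ≡ W F + W G →
         weight w ((x ∷ F) ∪ (y ∷ G)) + weight w ((x ∷ F) ∩ (y ∷ G)) ≡ weight w (x ∷ F) + weight w (y ∷ G)
  cons inside  inside  ih = begin
    (a + W (F ∪ G)) + (a + W (F ∩ G)) ≡⟨ interchange a _ a _ ⟩
    (a + a) + (W (F ∪ G) + W (F ∩ G)) ≡⟨ cong (a + a +_) ih ⟩
    (a + a) + (W F + W G)             ≡⟨ interchange a a _ _ ⟩
    (a + W F) + (a + W G)             ∎
    where open ≡-Reasoning
  cons inside  outside ih = trans (+-assoc a _ _) (trans (cong (a +_) ih) (sym (+-assoc a _ _)))
  cons outside inside  ih = trans (+-assoc a _ _) (trans (cong (a +_) ih) (x∙yz≈y∙xz a (W F) (W G)))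
  cons outside outside ih = ih

∣p∪q∣+∣p∩q∣≡∣p∣+∣q∣ : ∀ {n} (p q : Subset n) → ∣ p ∪ q ∣ + ∣ p ∩ q ∣ ≡ ∣ p ∣ + ∣ q ∣
∣p∪q∣+∣p∩q∣≡∣p∣+∣q∣ p q = begin
  ∣ p ∪ q ∣ + ∣ p ∩ q ∣                   ≡⟨ sym (cong₂ _+_ (∣∣≡weight (p ∪ q)) (∣∣≡weight (p ∩ q))) ⟩
  weight one (p ∪ q) + weight one (p ∩ q) ≡⟨ weight-modular one p q ⟩
  weight one p + weight one q             ≡⟨ cong₂ _+_ (∣∣≡weight p) (∣∣≡weight q) ⟩
  ∣ p ∣ + ∣ q ∣                           ∎
  where
  open ≡-Reasoning
  one = const 1
  ∣∣≡weight : ∀ p → weight one p ≡ ∣ p ∣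
  ∣∣≡weight p = trans (weight-const 1 p) (*-identityˡ ∣ p ∣)

count-modular : ∀ {m} (P Q : Fin m → Bool) →
                count P + count Q ≡ count (λ j → P j ∨ Q j) + count (λ j → P j ∧ Q j)
count-modular P Q = begin
  count P + count Q                                         ≡⟨ cong₂ _+_ (count≡∣tabulate∣ P) (count≡∣tabulate∣ Q) ⟩
  ∣ tabulate P ∣ + ∣ tabulate Q ∣                           ≡⟨ sym (∣p∪q∣+∣p∩q∣≡∣p∣+∣q∣ (tabulate P) (tabulate Q)) ⟩
  ∣ tabulate P ∪ tabulate Q ∣ + ∣ tabulate P ∩ tabulate Q ∣ ≡⟨ sym (cong₂ (λ X Y → ∣ X ∣ + ∣ Y ∣) (tabulate-∨ P Q) (tabulate-∧ P Q)) ⟩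
  ∣ tabulate P∨Q ∣ + ∣ tabulate P∧Q ∣                       ≡⟨ sym (cong₂ _+_ (count≡∣tabulate∣ P∨Q) (count≡∣tabulate∣ P∧Q)) ⟩
  count P∨Q + count P∧Q                                     ∎
  where
  open ≡-Reasoning
  P∨Q P∧Q : _ → Bool
  P∨Q j = P j ∨ Q j
  P∧Q j = P j ∧ Q j

weight-vanishing : ∀ {n} {w : Fin n → ℕ} F → (∀ {u} → u ∈ F → w u ≡ 0) → weight w F ≡ 0
weight-vanishing F w≡0 = n≤0⇒n≡0 (≤-trans (weight-mono F (≤-reflexive ∘ w≡0)) (≤-reflexive (weight-const 0 F)))

weight-point : ∀ {n} {w : Fin n → ℕ} {v} F → v ∈ F → (∀ {u} → u ∈ F → u ≢ v → w u ≡ 0) → weight w F ≡ w v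
weight-point {v = zero}  (inside ∷ F) here w≡0 =
  trans (cong (_ +_) (weight-vanishing F (λ u∈F → w≡0 (there u∈F) λ ()))) (+-identityʳ _)
weight-point {v = suc v} (inside ∷ F) (there v∈F) w≡0 =
  cong₂ _+_ (w≡0 here λ ()) (weight-point F v∈F (λ u∈F u≢v → w≡0 (there u∈F) (u≢v ∘ suc-injective)))
weight-point {v = suc v} (outside ∷ F) (there v∈F) w≡0 =
  weight-point F v∈F (λ u∈F u≢v → w≡0 (there u∈F) (u≢v ∘ suc-injective))

count-preimage : ∀ {m n} (g : Fin m → Fin n) F →
                 count (λ j → ⌊ g j ∈? F ⌋) ≡ weight (λ u → count (λ j → ⌊ g j ≟ u ⌋)) F
count-preimage {zero}  g F = sym (weight-const 0 F)
count-preimage {suc m} g F = begin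
  (if ⌊ g zero ∈? F ⌋ then 1 else 0) + count (λ j → ⌊ g (suc j) ∈? F ⌋)
    ≡⟨ cong₂ _+_ (sym weight-δ) (count-preimage (g ∘ suc) F) ⟩
  weight δ F + weight fibre F
    ≡⟨ weight-+ δ fibre F ⟨
  weight (λ u → δ u + fibre u) F ∎
  where
  open ≡-Reasoning
  δ fibre : _ → ℕ
  δ u     = if ⌊ g zero ≟ u ⌋ then 1 else 0
  fibre u = count (λ j → ⌊ g (suc j) ≟ u ⌋)
  δ-off : ∀ {u} → u ≢ g zero → δ u ≡ 0
  δ-off {u} u≢g₀ with g zero ≟ u
  ... | yes g₀≡u = ⊥-elim (u≢g₀ (sym g₀≡u))
  ... | no _     = refl
  δ-on : δ (g zero) ≡ 1
  δ-on with g zero ≟ g zero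
  ... | yes _   = refl
  ... | no g₀≢g₀ = ⊥-elim (g₀≢g₀ refl)
  weight-δ : weight δ F ≡ (if ⌊ g zero ∈? F ⌋ then 1 else 0)
  weight-δ with g zero ∈? F
  ... | yes g₀∈F = trans (weight-point F g₀∈F (λ _ → δ-off)) δ-on
  ... | no  g₀∉F = weight-vanishing F (λ u∈F → δ-off (λ u≡g₀ → g₀∉F (subst (_∈ F) u≡g₀ u∈F)))

weight-updateAt-∉ : ∀ {n} (w : Fin n → ℕ) {v} f F → v ∉ F → weight (updateAt w v f) F ≡ weight w F
weight-updateAt-∉ w {zero}  f (inside  ∷ F) v∉F = ⊥-elim (v∉F here)
weight-updateAt-∉ w {zero}  f (outside ∷ F) v∉F = refl
weight-updateAt-∉ w {suc v} f (inside  ∷ F) v∉F = cong (w zero +_) (weight-updateAt-∉ (w ∘ suc) f F (v∉F ∘ there))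
weight-updateAt-∉ w {suc v} f (outside ∷ F) v∉F = weight-updateAt-∉ (w ∘ suc) f F (v∉F ∘ there)

weight≤suc-weight-pred : ∀ {n} (w : Fin n → ℕ) v F → weight w F ≤ suc (weight (updateAt w v pred) F)
weight≤suc-weight-pred w zero    (inside  ∷ F) = +-monoˡ-≤ (weight (w ∘ suc) F) (n≤suc-pred (w zero))
  where
  n≤suc-pred : ∀ x → x ≤ suc (pred x)
  n≤suc-pred zero    = z≤n
  n≤suc-pred (suc x) = ≤-refl
weight≤suc-weight-pred w zero    (outside ∷ F) = n≤1+n _
weight≤suc-weight-pred w (suc v) (inside  ∷ F) =
  ≤-trans (+-monoʳ-≤ (w zero) (weight≤suc-weight-pred (w ∘ suc) v F)) (≤-reflexive (+-suc (w zero) _))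
weight≤suc-weight-pred w (suc v) (outside ∷ F) = weight≤suc-weight-pred (w ∘ suc) v F

-- Hakimi's theorem

module _ {n s : ℕ} where

  within : ∀ {m} → (Fin m → Fin s → Fin n) → Subset n → Fin m → Bool
  within e F j = ⌊ all? (λ a → e j a ∈? F) ⌋

  spanned : ∀ {m} → (Fin m → Fin s → Fin n) → (Fin m → Bool) → Subset n → ℕ
  spanned e act F = count (λ j → act j ∧ within e F j)

  load : ∀ {m} → (Fin m → Fin s → Fin n) → (Fin m → Bool) → (Fin m → Fin s) → Fin n → ℕ
  load e act σ u = count (λ j → act j ∧ ⌊ e j (σ j) ≟ u ⌋)

  Sparse : ∀ {m} → (Fin m → Fin s → Fin n) → (Fin m → Bool) → (Fin n → ℕ) → Set
  Sparse e act c = ∀ F → spanned e act F ≤ weight c F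

  Tight : ∀ {m} → (Fin m → Fin s → Fin n) → (Fin m → Bool) → (Fin n → ℕ) → Subset n → Set
  Tight e act c F = weight c F ≤ spanned e act F

  sparse? : ∀ {m} e act c → Dec (Sparse {m} e act c)
  sparse? e act c = allSubset? (λ F → spanned e act F ≤? weight c F)

  within-∪ˡ : ∀ {m} (e : Fin m → Fin s → Fin n) {F} G {j} → T (within e F j) → T (within e (F ∪ G) j)
  within-∪ˡ e G inF = fromWitness (λ a → x∈p∪q⁺ (inj₁ (toWitness inF a)))

  within-∪ʳ : ∀ {m} (e : Fin m → Fin s → Fin n) F {G j} → T (within e G j) → T (within e (F ∪ G) j)
  within-∪ʳ e F inG = fromWitness (λ a → x∈p∪q⁺ (inj₂ (toWitness inG a)))

  within-∩ : ∀ {m} (e : Fin m → Fin s → Fin n) {F G j} → T (within e F j) → T (within e G j) → T (within e (F ∩ G) j)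
  within-∩ e inF inG = fromWitness (λ a → x∈p∩q⁺ (toWitness inF a , toWitness inG a))

  spanned-supermodular : ∀ {m} (e : Fin m → Fin s → Fin n) act F G →
    spanned e act F + spanned e act G ≤ spanned e act (F ∪ G) + spanned e act (F ∩ G)
  spanned-supermodular e act F G = begin
    spanned e act F + spanned e act G              ≡⟨ count-modular (λ j → act j ∧ inF j) (λ j → act j ∧ inG j) ⟩
    count (λ j → (act j ∧ inF j) ∨ (act j ∧ inG j)) +
    count (λ j → (act j ∧ inF j) ∧ (act j ∧ inG j)) ≤⟨ +-mono-≤ (count-mono ∨-case) (count-mono ∧-case) ⟩
    spanned e act (F ∪ G) + spanned e act (F ∩ G)  ∎
    where
    open ≤-Reasoning
    inF inG : _ → Bool
    inF = within e F
    inG = within e G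
    ∨-case : ∀ j → T ((act j ∧ inF j) ∨ (act j ∧ inG j)) → T (act j ∧ within e (F ∪ G) j)
    ∨-case j PQ with act j
    ... | true = [ within-∪ˡ e G , within-∪ʳ e F ] (to (T-∨ {inF j}) PQ)
    ∧-case : ∀ j → T ((act j ∧ inF j) ∧ (act j ∧ inG j)) → T (act j ∧ within e (F ∩ G) j)
    ∧-case j PQ with act j
    ... | true = let (Fj , Gj) = to (T-∧ {inF j}) PQ in within-∩ e Fj Gj

  module _ {m} (e : Fin m → Fin s → Fin n) (act : Fin m → Bool) (c : Fin n → ℕ) (sparse : Sparse e act c) where

    tight-∪ : ∀ {F G} → Tight e act c F → Tight e act c G → Tight e act c (F ∪ G)
    tight-∪ {F} {G} tF tG = +-cancelʳ-≤ (weight c (F ∩ G)) _ _ (begin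
      weight c (F ∪ G) + weight c (F ∩ G)           ≡⟨ weight-modular c F G ⟩
      weight c F + weight c G                       ≤⟨ +-mono-≤ tF tG ⟩
      spanned e act F + spanned e act G             ≤⟨ spanned-supermodular e act F G ⟩
      spanned e act (F ∪ G) + spanned e act (F ∩ G) ≤⟨ +-monoʳ-≤ _ (sparse (F ∩ G)) ⟩
      spanned e act (F ∪ G) + weight c (F ∩ G)      ∎)
      where open ≤-Reasoning

    tight-⋃ : ∀ {k} (T : Fin k → Subset n) → (∀ i → Tight e act c (T i)) → Tight e act c (⋃ (List.tabulate T))
    tight-⋃ {zero}  T tight = ≤-trans (≤-reflexive (weight-⊥ c)) z≤n
    tight-⋃ {suc k} T tight = tight-∪ (tight zero) (tight-⋃ (T ∘ suc) (tight ∘ suc))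

  spanned-tail≤spanned : ∀ {m} (e : Fin (suc m) → Fin s → Fin n) act F →
                         spanned (e ∘ suc) (act ∘ suc) F ≤ spanned e act F
  spanned-tail≤spanned e act F = m≤n+m _ (if act zero ∧ within e F zero then 1 else 0)

  sparse-tail : ∀ {m} (e : Fin (suc m) → Fin s → Fin n) act c → Sparse e act c → Sparse (e ∘ suc) (act ∘ suc) c
  sparse-tail e act c sparse F = ≤-trans (spanned-tail≤spanned e act F) (sparse F)

  spanned-suc : ∀ {m} (e : Fin (suc m) → Fin s → Fin n) act F → T (act zero) → T (within e F zero) →
                spanned e act F ≡ suc (spanned (e ∘ suc) (act ∘ suc) F)
  spanned-suc e act F act₀ in₀ with act zero | within e F zero
  ... | true | true = refl

  tight-set-through : ∀ {m} (e : Fin (suc m) → Fin s → Fin n) act c → Sparse e act c → ∀ v →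
                  ¬ (1 ≤ c v × Sparse (e ∘ suc) (act ∘ suc) (updateAt c v pred)) →
                  ∃ λ F → v ∈ F × Tight (e ∘ suc) (act ∘ suc) c F
  tight-set-through e act c sparse v stuck with 1 ≤? c v
  ... | no cv≱1 = ⁅ v ⁆ , x∈⁅x⁆ v , ≤-trans (≤-reflexive (trans (weight-⁅⁆ c v) (n<1⇒n≡0 (≰⇒> cv≱1)))) z≤n
  ... | yes cv≥1 with anySubset? (λ F → weight (updateAt c v pred) F <? spanned (e ∘ suc) (act ∘ suc) F)
  ...   | no ∄F = ⊥-elim (stuck (cv≥1 , λ F → ≮⇒≥ (λ over → ∄F (F , over))))
  ...   | yes (F , over) with v ∈? F
  ...     | yes v∈F = F , v∈F , ≤-trans (weight≤suc-weight-pred c v F) over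
  ...     | no  v∉F = ⊥-elim (<-irrefl refl (begin-strict
    weight c F                          ≡⟨ weight-updateAt-∉ c pred F v∉F ⟨
    weight (updateAt c v pred) F        <⟨ over ⟩
    spanned (e ∘ suc) (act ∘ suc) F     ≤⟨ spanned-tail≤spanned e act F ⟩
    spanned e act F                     ≤⟨ sparse F ⟩
    weight c F                          ∎))
    where open ≤-Reasoning

  first-edge-placeable : ∀ {m} (e : Fin (suc m) → Fin s → Fin n) act c → Sparse e act c → T (act zero) →
    ∃ λ a → 1 ≤ c (e zero a) × Sparse (e ∘ suc) (act ∘ suc) (updateAt c (e zero a) pred)
  first-edge-placeable e act c sparse act₀
    with any? (λ a → 1 ≤? c (e zero a) ×-dec sparse? (e ∘ suc) (act ∘ suc) (updateAt c (e zero a) pred))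
  ... | yes placeable = placeable
  ... | no  stuck     = ⊥-elim (<-irrefl refl (begin-strict
    spanned (e ∘ suc) (act ∘ suc) U     <⟨ n<1+n _ ⟩
    suc (spanned (e ∘ suc) (act ∘ suc) U) ≡⟨ spanned-suc e act U act₀ (fromWitness (λ a → ∈-⋃-tabulate⁺ F a (∋e₀ a))) ⟨
    spanned e act U                     ≤⟨ sparse U ⟩
    weight c U                          ≤⟨ tight-⋃ (e ∘ suc) (act ∘ suc) c (sparse-tail e act c sparse) F (proj₂ ∘ proj₂ ∘ through) ⟩
    spanned (e ∘ suc) (act ∘ suc) U     ∎))
    where
    open ≤-Reasoning
    through : ∀ a → ∃ λ F → e zero a ∈ F × Tight (e ∘ suc) (act ∘ suc) c F
    through a = tight-set-through e act c sparse (e zero a) (λ placeable → stuck (a , placeable))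
    F : Fin s → Subset n
    F = proj₁ ∘ through
    ∋e₀ : ∀ a → e zero a ∈ F a
    ∋e₀ = proj₁ ∘ proj₂ ∘ through
    U = ⋃ (List.tabulate F)

capacity-after-placing : ∀ {n} (c : Fin n → ℕ) {v} u → 1 ≤ c v → (if ⌊ v ≟ u ⌋ then 1 else 0) + updateAt c v pred u ≤ c u
capacity-after-placing c {v} u cv≥1 with v ≟ u
... | yes refl = ≤-reflexive (trans (cong suc (updateAt-updates v c)) (suc-pred (c v) {{>-nonZero cv≥1}}))
... | no  v≢u  = ≤-reflexive (updateAt-minimal u v c (v≢u ∘ sym))

hakimi : ∀ {m n s} (e : Fin m → Fin (suc s) → Fin n) act c → Sparse e act c →
         ∃ λ σ → ∀ u → load e act σ u ≤ c u
hakimi {zero}  e act c sparse = (λ ()) , λ _ → z≤n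
hakimi {suc m} e act c sparse = place (act zero) refl
  where
  open ≤-Reasoning
  place : ∀ b → act zero ≡ b → ∃ λ σ → ∀ u → load e act σ u ≤ c u
  place false act₀ with hakimi (e ∘ suc) (act ∘ suc) c (sparse-tail e act c sparse)
  ... | σ′ , fits = (zero Vector.∷ σ′) , λ u → ≤-trans (≤-reflexive (load-inactive u)) (fits u)
    where
    load-inactive : ∀ u → load e act (zero Vector.∷ σ′) u ≡ load (e ∘ suc) (act ∘ suc) σ′ u
    load-inactive u rewrite act₀ = refl
  place true act₀ with first-edge-placeable e act c sparse (subst T (sym act₀) _)
  ... | a , cv≥1 , sparse′ with hakimi (e ∘ suc) (act ∘ suc) (updateAt c (e zero a) pred) sparse′
  ...   | σ′ , fits = (a Vector.∷ σ′) , λ u → begin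
    load e act (a Vector.∷ σ′) u                                                     ≡⟨ load-active u ⟩
    (if ⌊ e zero a ≟ u ⌋ then 1 else 0) + load (e ∘ suc) (act ∘ suc) σ′ u    ≤⟨ +-monoʳ-≤ _ (fits u) ⟩
    (if ⌊ e zero a ≟ u ⌋ then 1 else 0) + updateAt c (e zero a) pred u       ≤⟨ capacity-after-placing c u cv≥1 ⟩
    c u                                                                       ∎
    where
    load-active : ∀ u → load e act (a Vector.∷ σ′) u ≡ (if ⌊ e zero a ≟ u ⌋ then 1 else 0) + load (e ∘ suc) (act ∘ suc) σ′ u
    load-active u rewrite act₀ = refl

-- Permutations avoiding forbidden slots

transpose-matchˡ : ∀ {r} (i j : Fin r) → PC.transpose i j i ≡ j
transpose-matchˡ i j with i ≟ i
... | yes _   = refl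
... | no  i≢i = ⊥-elim (i≢i refl)

transpose-matchʳ : ∀ {r} (i j : Fin r) → PC.transpose i j j ≡ i
transpose-matchʳ i j with j ≟ i
... | yes refl = refl
... | no  _ with j ≟ j
...   | yes _   = refl
...   | no  j≢j = ⊥-elim (j≢j refl)

transpose-mismatch : ∀ {r} {i j k : Fin r} → k ≢ i → k ≢ j → PC.transpose i j k ≡ k
transpose-mismatch {i = i} {j} {k} k≢i k≢j with k ≟ i
... | yes k≡i = ⊥-elim (k≢i k≡i)
... | no  _ with k ≟ j
...   | yes k≡j = ⊥-elim (k≢j k≡j)
...   | no  _   = refl

module _ {r : ℕ} (Forbidden : Fin r → Fin r → Set) (forbidden? : ∀ p a → Dec (Forbidden p a))
         (forbidden-unique : ∀ {p q a} → Forbidden p a → Forbidden q a → p ≡ q)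
         (allowed : ∀ p → ∃ λ a → ¬ Forbidden p a) where

  Avoids : Permutation′ r → Fin r → Set
  Avoids ρ p = ¬ Forbidden p (ρ ⟨$⟩ʳ p)

  -- Swap p with the holder of an allowed slot a of p: the holder receives p's old slot,
  -- which p forbids, so the holder cannot forbid it.
  repair : ∀ ρ p → ∃ λ ρ′ → Avoids ρ′ p × (∀ q → Avoids ρ q → Avoids ρ′ q)
  repair ρ p with forbidden? p (ρ ⟨$⟩ʳ p)
  ... | no  avoids = ρ , avoids , λ _ avoidsq → avoidsq
  ... | yes forbids = ρ′ , avoids-p , keeps
    where
    a      = proj₁ (allowed p)
    holder = ρ ⟨$⟩ˡ a
    ρ′     = transpose p holder ∘ₚ ρ
    avoids-p : Avoids ρ′ p
    avoids-p rewrite transpose-matchˡ p holder | inverseʳ ρ {a} = proj₂ (allowed p)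
    keeps : ∀ q → Avoids ρ q → Avoids ρ′ q
    keeps q avoids-q = by-cases (q ≟ p) (q ≟ holder)
      where
      by-cases : Dec (q ≡ p) → Dec (q ≡ holder) → Avoids ρ′ q
      by-cases (yes q≡p) _          = subst (Avoids ρ′) (sym q≡p) avoids-p
      by-cases (no  q≢p) (yes q≡h)  = λ forbids-q → q≢p (forbidden-unique (subst (Forbidden q ∘ (ρ ⟨$⟩ʳ_))
                                        (trans (cong (PC.transpose p holder) q≡h) (transpose-matchʳ p holder)) forbids-q) forbids)
      by-cases (no  q≢p) (no  q≢h) rewrite transpose-mismatch q≢p q≢h = avoids-q

  avoid-all : ∀ (ps : List (Fin r)) → ∃ λ ρ → All (Avoids ρ) ps
  avoid-all []       = Permutation.id , []
  avoid-all (p ∷ ps) with avoid-all ps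
  ... | ρ , avoids with repair ρ p
  ...   | ρ′ , avoids-p , keeps = ρ′ , avoids-p ∷ All.map (λ {q} → keeps q) avoids

  avoiding-permutation : ∃ λ (ρ : Permutation′ r) → ∀ p → ¬ Forbidden p (ρ ⟨$⟩ʳ p)
  avoiding-permutation with avoid-all (allFin r)
  ... | ρ , avoids = ρ , λ p → All.lookup avoids (∈-allFin p)

-- Orientations versus admissible families

module WitnessClasses {n r p} {P : Fin r → Fin n → Set p} (P? : ∀ v → Dec (∃ λ i → P i v)) where

  chosen : ∀ {v} → Dec (∃ λ i → P i v) → Fin r → Bool
  chosen (yes (i , _)) i′ = ⌊ i ≟ i′ ⌋
  chosen (no  _)       _  = false

  class : Fin r → Subset n
  class i = tabulate (λ v → chosen (P? v) i)

  class-sound : ∀ {i v} → v ∈ class i → P i v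
  class-sound {i} {v} v∈ with P? v | ∈-tabulate⁻ v v∈
  ... | yes (i′ , Pi′v) | i′≡i = subst (λ i → P i v) (toWitness i′≡i) Pi′v

  class-disjoint : ∀ {i i′ v} → v ∈ class i → v ∈ class i′ → i ≡ i′
  class-disjoint {v = v} v∈ v∈′ with P? v | ∈-tabulate⁻ v v∈ | ∈-tabulate⁻ v v∈′
  ... | yes _ | i₀≡i | i₀≡i′ = trans (sym (toWitness i₀≡i)) (toWitness i₀≡i′)

  class-complete : ∀ {i v} → P i v → ∃ λ i′ → v ∈ class i′
  class-complete {v = v} Piv with P? v in eq
  ... | yes (i , _) = i , ∈-tabulate⁺ v (subst (λ d → T (chosen d i)) (sym eq) (fromWitness refl))
  ... | no  ∄i      = ⊥-elim (∄i (_ , Piv))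

saturated? : ∀ {n r} (H : Hypergraph n r) → Orientation H → ℕ → Fin n → Bool
saturated? H D k v = ⌊ all? (λ i → k ≤? deg H D i v) ⌋

saturated : ∀ {n r} (H : Hypergraph n r) → Orientation H → ℕ → Subset n
saturated H D k = tabulate (saturated? H D k)

module _ {n r} (H : Hypergraph n r) (D : Orientation H) (k : ℕ) where

  n∸fD≡∣∁saturated∣ : n ∸ fD H D k ≡ ∣ ∁ (saturated H D k) ∣
  n∸fD≡∣∁saturated∣ = trans (cong (n ∸_) (count≡∣tabulate∣ (saturated? H D k))) (sym (∣∁p∣≡n∸∣p∣ (saturated H D k)))

  fD≤n : fD H D k ≤ n
  fD≤n = ≤-trans (≤-reflexive (count≡∣tabulate∣ (saturated? H D k))) (∣p∣≤n (saturated H D k))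

  ∈-∁saturated⁺ : ∀ {i v} → deg H D i v < k → v ∈ ∁ (saturated H D k)
  ∈-∁saturated⁺ {i} {v} deg<k = x∉p⇒x∈∁p (λ v∈sat → <⇒≱ deg<k (toWitness (∈-tabulate⁻ v v∈sat) i))

  ∈-∁saturated⁻ : ∀ {v} → v ∈ ∁ (saturated H D k) → ∃ λ i → deg H D i v < k
  ∈-∁saturated⁻ {v} v∈∁ with ¬∀⟶∃¬ r _ (λ i → k ≤? deg H D i v) (x∈∁p⇒x∉p v∈∁ ∘ ∈-tabulate⁺ v ∘ fromWitness)
  ... | i , k≰deg = i , ≰⇒> k≰deg

MadLe-intro : ∀ {n r} (H : Hypergraph n r) {A j} → (∀ F → F ⊆ A → eIn H F ≤ j * ∣ F ∣) → MadLe H A j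
MadLe-intro {r = r} H {j = j} bound F F⊆A _ = ≤-trans (*-monoʳ-≤ r (bound F F⊆A)) (≤-reflexive (sym (*-assoc r j ∣ F ∣)))

MadLe-elim : ∀ {n r} (H : Hypergraph n (suc r)) {A j} → MadLe H A j → ∀ F → F ⊆ A → eIn H F ≤ j * ∣ F ∣
MadLe-elim {r = r} H {A} {j} mad F F⊆A with nonempty? F
... | yes ne    = *-cancelˡ-≤ (suc r) (≤-trans (mad F F⊆A ne) (≤-reflexive (*-assoc (suc r) j ∣ F ∣)))
... | no  empty = ≤-trans (count-mono {Q = const false} (λ ℓ inF → empty (edge H ℓ zero , toWitness inF zero)))
                          (≤-trans (≤-reflexive (count-false {m H})) z≤n)

admissible-from-orientation : ∀ {n r} (H : Hypergraph n r) (D : Orientation H) j →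
  ∃ λ A → Admissible H j A × unionSize A ≡ n ∸ fD H D (suc j)
admissible-from-orientation {n} {r} H D j = class , (disjoint , sparse) , size
  where
  open WitnessClasses (λ v → any? (λ i → deg H D i v <? suc j))
  disjoint : ∀ i i′ v → v ∈ class i → v ∈ class i′ → i ≡ i′
  disjoint _ _ _ = class-disjoint
  sparse : ∀ i → MadLe H (class i) j
  sparse i = MadLe-intro H λ F F⊆class → begin
    eIn H F                                  ≤⟨ count-mono {Q = λ ℓ → ⌊ at H D ℓ i ∈? F ⌋} (λ ℓ inF → fromWitness (toWitness inF (D ℓ ⟨$⟩ʳ i))) ⟩
    count (λ ℓ → ⌊ at H D ℓ i ∈? F ⌋)        ≡⟨ count-preimage (λ ℓ → at H D ℓ i) F ⟩
    weight (deg H D i) F                     ≤⟨ weight-mono F (λ u∈F → s≤s⁻¹ (class-sound (F⊆class u∈F))) ⟩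
    weight (const j) F                       ≡⟨ weight-const j F ⟩
    j * ∣ F ∣                                ∎
    where open ≤-Reasoning
  ⋃class≡∁saturated : ⋃ (List.tabulate class) ≡ ∁ (saturated H D (suc j))
  ⋃class≡∁saturated = ⊆-antisym
    (λ v∈⋃ → let i , v∈class = ∈-⋃-tabulate⁻ class v∈⋃ in ∈-∁saturated⁺ H D (suc j) (class-sound v∈class))
    (λ v∈∁ → let i , deg<k = ∈-∁saturated⁻ H D (suc j) v∈∁ ; i′ , v∈class = class-complete deg<k in
             ∈-⋃-tabulate⁺ class i′ v∈class)
  size : unionSize class ≡ n ∸ fD H D (suc j)
  size = trans (cong ∣_∣ ⋃class≡∁saturated) (sym (n∸fD≡∣∁saturated∣ H D (suc j)))

module FromAdmissible {n r} (H : Hypergraph n (suc r)) {j} {A : Fin (suc r) → Subset n} (adm : Admissible H j A) where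

  private
    disjoint = proj₁ adm

    inClass : Fin (suc r) → Fin (m H) → Bool
    inClass i = within (edge H) (A i)

    class-sparse : ∀ i → Sparse (edge H) (inClass i) (const j)
    class-sparse i F = begin
      spanned (edge H) (inClass i) F ≤⟨ count-mono {Q = within (edge H) (A i ∩ F)} both-within ⟩
      eIn H (A i ∩ F)                 ≤⟨ MadLe-elim H {j = j} (proj₂ adm i) (A i ∩ F) (p∩q⊆p (A i) F) ⟩
      j * ∣ A i ∩ F ∣                 ≤⟨ *-monoʳ-≤ j (∣p∩q∣≤∣q∣ (A i) F) ⟩
      j * ∣ F ∣                       ≡⟨ weight-const j F ⟨
      weight (const j) F              ∎
      where
      open ≤-Reasoning
      both-within : ∀ ℓ → T (inClass i ℓ ∧ within (edge H) F ℓ) → T (within (edge H) (A i ∩ F) ℓ)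
      both-within ℓ both = let inA , inF = to (T-∧ {inClass i ℓ}) both in within-∩ (edge H) inA inF

    head-of-class : ∀ i → Fin (m H) → Fin (suc r)
    head-of-class i = proj₁ (hakimi (edge H) (inClass i) (const j) (class-sparse i))

    Contained : Fin (m H) → Set
    Contained ℓ = ∃ λ i → ∀ a → edge H ℓ a ∈ A i

    contained? : ∀ ℓ → Dec (Contained ℓ)
    contained? ℓ = any? (λ i → all? (λ a → edge H ℓ a ∈? A i))

    avoiding-classes : ∀ ℓ → ¬ Contained ℓ → ∃ λ ρ → ∀ p → ¬ edge H ℓ (ρ ⟨$⟩ʳ p) ∈ A p
    avoiding-classes ℓ straddles =
      avoiding-permutation (λ p a → edge H ℓ a ∈ A p) (λ p a → edge H ℓ a ∈? A p) (disjoint _ _ _) allowed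
      where
      allowed : ∀ p → ∃ λ a → ¬ edge H ℓ a ∈ A p
      allowed p = ¬∀⟶∃¬ _ _ (λ a → edge H ℓ a ∈? A p) (λ ⊆Ap → straddles (p , ⊆Ap))

    orient : ∀ ℓ → Dec (Contained ℓ) → Permutation′ (suc r)
    orient ℓ (yes (i , _))   = transpose i (head-of-class i ℓ)
    orient ℓ (no  straddles) = proj₁ (avoiding-classes ℓ straddles)

    D : Orientation H
    D ℓ = orient ℓ (contained? ℓ)

    placed : ∀ ℓ d {i v} → v ∈ A i → edge H ℓ (orient ℓ d ⟨$⟩ʳ i) ≡ v →
             (∀ a → edge H ℓ a ∈ A i) × edge H ℓ (head-of-class i ℓ) ≡ v
    placed ℓ (yes (i′ , ⊆Ai′)) {i} v∈Ai at≡v with disjoint i i′ _ v∈Ai (subst (_∈ A i′) at≡v (⊆Ai′ _))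
    ... | refl = ⊆Ai′ , trans (cong (edge H ℓ) (sym (transpose-matchˡ i (head-of-class i ℓ)))) at≡v
    placed ℓ (no straddles) {i} v∈Ai at≡v =
      ⊥-elim (proj₂ (avoiding-classes ℓ straddles) i (subst (_∈ A i) (sym at≡v) v∈Ai))

    deg≤ : ∀ {i v} → v ∈ A i → deg H D i v ≤ j
    deg≤ {i} {v} v∈Ai = ≤-trans (count-mono {Q = λ ℓ → inClass i ℓ ∧ ⌊ edge H ℓ (head-of-class i ℓ) ≟ v ⌋} counted)
                                (proj₂ (hakimi (edge H) (inClass i) (const j) (class-sparse i)) v)
      where
      counted : ∀ ℓ → T ⌊ at H D ℓ i ≟ v ⌋ → T (inClass i ℓ ∧ ⌊ edge H ℓ (head-of-class i ℓ) ≟ v ⌋)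
      counted ℓ at≡v = let ⊆Ai , head≡v = placed ℓ (contained? ℓ) v∈Ai (toWitness at≡v) in
        from (T-∧ {inClass i ℓ}) (fromWitness ⊆Ai , fromWitness head≡v)

  unionSize≤n∸fD : ∃ λ D → unionSize A ≤ n ∸ fD H D (suc j)
  unionSize≤n∸fD = D , (begin
    ∣ ⋃ (List.tabulate A) ∣          ≤⟨ p⊆q⇒∣p∣≤∣q∣ ⋃A⊆∁saturated ⟩
    ∣ ∁ (saturated H D (suc j)) ∣    ≡⟨ n∸fD≡∣∁saturated∣ H D (suc j) ⟨
    n ∸ fD H D (suc j)               ∎)
    where
    open ≤-Reasoning
    ⋃A⊆∁saturated : ⋃ (List.tabulate A) ⊆ ∁ (saturated H D (suc j))
    ⋃A⊆∁saturated v∈⋃ = let i , v∈Ai = ∈-⋃-tabulate⁻ A v∈⋃ in ∈-∁saturated⁺ H D (suc j) (s≤s (deg≤ v∈Ai))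

orientation-from-admissible : ∀ {n r} (H : Hypergraph n r) {j A} → Admissible H j A →
  ∃ λ D → unionSize A ≤ n ∸ fD H D (suc j)
orientation-from-admissible {n} {zero}  H _   = (λ _ → Permutation.id) , ≤-trans (≤-reflexive (∣⊥∣≡0 n)) z≤n
orientation-from-admissible {r = suc r} H adm = FromAdmissible.unionSize≤n∸fD H adm

-- Existence of M(H, j)

maximum-below : ∀ {ℓ} {P : Pred ℕ ℓ} → Decidable P → P 0 → ∀ N → ∃ λ y → P y × (∀ z → P z → z ≤ N → z ≤ y)
maximum-below P? P0 zero = 0 , P0 , λ _ _ z≤0 → z≤0
maximum-below {P = P} P? P0 (suc N) with P? (suc N)
... | yes PN = suc N , PN , λ _ _ z≤N → z≤N
... | no ¬PN with maximum-below P? P0 N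
...   | y , Py , max = y , Py , λ z Pz z≤1+N → max z Pz (s≤s⁻¹ (≤∧≢⇒< z≤1+N (λ z≡1+N → ¬PN (subst P z≡1+N Pz))))

anyFamily? : ∀ {n r ℓ} {P : Pred (Fin r → Subset n) ℓ} → (∀ {A B} → A ≗ B → P A → P B) → Decidable P → Dec (∃ P)
anyFamily? {r = zero} resp P? with P? (λ ())
... | yes PA = yes (_ , PA)
... | no ¬PA = no λ (A , PA) → ¬PA (resp (λ ()) PA)
anyFamily? {r = suc r} resp P? with anySubset? (λ F → anyFamily? (resp ∘ ∷-cong F) (P? ∘ (F Vector.∷_)))
  where
  ∷-cong : ∀ F {A B} → A ≗ B → (F Vector.∷ A) ≗ (F Vector.∷ B)
  ∷-cong F A≗B zero    = refl
  ∷-cong F A≗B (suc i) = A≗B i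
... | yes (F , A , PFA) = yes (F Vector.∷ A , PFA)
... | no  ∄A            = no λ (A , PA) → ∄A (head A , tail A , resp head∷tail PA)
  where
  head∷tail : ∀ {A} → A ≗ (head A Vector.∷ tail A)
  head∷tail zero    = refl
  head∷tail (suc i) = refl

admissible? : ∀ {n r} (H : Hypergraph n r) j A → Dec (Admissible H j A)
admissible? {r = r} H j A =
  all? (λ i → all? (λ i′ → all? (λ v → v ∈? A i →-dec (v ∈? A i′ →-dec i ≟ i′))))
  ×-dec all? (λ i → allSubset? (λ F → F ⊆? A i →-dec (nonempty? F →-dec r * eIn H F ≤? (r * j) * ∣ F ∣)))

admissible-resp : ∀ {n r} (H : Hypergraph n r) j {A B} → A ≗ B → Admissible H j A → Admissible H j B
admissible-resp H j A≗B (disjoint , sparse) =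
  (λ i i′ v v∈Bi v∈Bi′ → disjoint i i′ v (subst (v ∈_) (sym (A≗B i)) v∈Bi) (subst (v ∈_) (sym (A≗B i′)) v∈Bi′)) ,
  (λ i → subst (λ S → MadLe H S j) (A≗B i) (sparse i))

unionSize-resp : ∀ {n r} {A B : Fin r → Subset n} → A ≗ B → unionSize A ≡ unionSize B
unionSize-resp A≗B = cong (∣_∣ ∘ ⋃) (tabulate-cong A≗B)

M-exists : ∀ {n r} (H : Hypergraph n r) j → ∃ (IsMHj H j)
M-exists {n} H j with maximum-below Large? (empty , empty-admissible , z≤n) n
  where
  Large : Pred ℕ _
  Large y = ∃ λ A → Admissible H j A × y ≤ unionSize A
  Large? : Decidable Large
  Large? y = anyFamily? (λ A≗B (adm , y≤) → admissible-resp H j A≗B adm , subst (y ≤_) (unionSize-resp A≗B) y≤)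
                        (λ A → admissible? H j A ×-dec y ≤? unionSize A)
  empty = λ _ → ⊥
  empty-admissible : Admissible H j empty
  empty-admissible = (λ _ _ _ v∈⊥ _ → ⊥-elim (∉⊥ v∈⊥)) , (λ _ _ F⊆⊥ (_ , x∈F) → ⊥-elim (∉⊥ (F⊆⊥ x∈F)))
... | y , (A , adm , y≤∣A∣) , max = y , (A , adm , ≤-antisym (maximal A adm) y≤∣A∣) , maximal
  where
  maximal : ∀ A → Admissible H j A → unionSize A ≤ y
  maximal A adm = max _ (A , adm , ≤-refl) (∣p∣≤n (⋃ (List.tabulate A)))

fH1k≡n∸M : ∀ {n r} (H : Hypergraph n r) j {y} → IsMHj H j y → IsFH1k H (suc j) (n ∸ y)
fH1k≡n∸M {n} H j {y} ((A , adm , ∣A∣≡y) , maximal) with orientation-from-admissible H adm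
... | D , ∣A∣≤n∸fD = (D , fD≡n∸y) , n∸y≤fD
  where
  n∸fD≤y : ∀ D → n ∸ fD H D (suc j) ≤ y
  n∸fD≤y D = let A′ , adm′ , ∣A′∣≡ = admissible-from-orientation H D j in subst (_≤ y) ∣A′∣≡ (maximal A′ adm′)
  n∸y≤fD : ∀ D → n ∸ y ≤ fD H D (suc j)
  n∸y≤fD D = ≤-trans (∸-monoʳ-≤ n (n∸fD≤y D)) (≤-reflexive (m∸[m∸n]≡n (fD≤n H D (suc j))))
  fD≡n∸y : fD H D (suc j) ≡ n ∸ y
  fD≡n∸y = trans (sym (m∸[m∸n]≡n (fD≤n H D (suc j))))
                 (cong (n ∸_) (≤-antisym (n∸fD≤y D) (subst (_≤ n ∸ fD H D (suc j)) ∣A∣≡y ∣A∣≤n∸fD)))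

theorem2 : ∀ {n r : ℕ} (H : Hypergraph n r) (k : ℕ) → 1 ≤ k →
    Σ ℕ (λ y → IsMHj H (k ∸ 1) y × IsFH1k H k (n ∸ y))
theorem2 H (suc j) _ = let y , isM = M-exists H j in y , isM , fH1k≡n∸M H j isM
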